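{- Let $\mathcal{T}$ be a timed MSR system, $\mathcal{S}_0$ an initial configuration and $\mathcal{CS}$ a critical configuration specification, with properties taken with respect to $\mathcal{S}_0$, $\mathcal{CS}$ and lazy time sampling. If $\mathcal{T}$ satisfies the $L$ property, then $\mathcal{T}$ satisfies the $V$ property. Conversely, a timed MSR system satisfying the $V$ property need not satisfy the $L$ property: there exist a timed MSR system, an initial configuration and a critical configuration specification for which $V$ holds but $L$ fails.
   Context: A fact is $P(u_1,\dots,u_n)$ over a finite first-order typed alphabet; a timestamped fact is $F@t$, $t\in\mathbb{N}$. A configuration is a finite multiset of ground timestamped facts with exactly one fact $Time@t$ (global time $t$). The $Tick$ rule is $Time@T\to Time@(T+1)$. An instantaneous rule has the form $Time@T, W_1@T_1,\dots,W_p@T_p, F_1@T_1',\dots,F_n@T_n' \mid \mathcal{C} \to \exists \vec X.[Time@T, W_1@T_1,\dots,W_p@T_p, Q_1@(T+d_1),\dots,Q_m@(T+d_m)]$ with $d_i\in\mathbb{N}$, $\mathcal{C}$ a set of constraints $T_a>T_b\pm d$ or $T_a=T_b\pm d$ over the precondition's time variables, $\vec X$ fresh values. A rule $\mathcal{W}\mid\mathcal{C}\to\exists\vec X.\mathcal{W}'$ applies to $\mathcal{S}$ if for a ground substitution $\sigma$, $\mathcal{W}\sigma\subseteq\mathcal{S}$ and $\mathcal{C}\sigma$ holds, giving $((\mathcal{S}\setminus\mathcal{W})\cup\mathcal{W}')\sigma$. A timed MSR system is a set of instantaneous rules plus $Tick$. A trace is a finite or infinite sequence of single rule applications; an infinite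 time trace is one in which the global time exceeds every $n\in\mathbb{N}$. A critical configuration specification is a set of pairs $\langle\mathcal{S}_j,\mathcal{C}_j\rangle$, $\mathcal{S}_j$ a finite multiset of facts $F@T$ with time variables, $\mathcal{C}_j$ constraints on them; $\mathcal{S}$ is critical if some $\mathcal{S}_j\sigma\subseteq\mathcal{S}$ with $\mathcal{C}_j\sigma$ true for a ground substitution $\sigma$ (nonces renamed). A trace is compliant if it contains no critical configuration. A trace uses lazy time sampling (l.t.s.) if whenever $\mathcal{S}_i\to_{Tick}\mathcal{S}_{i+1}$ occurs, no instantaneous rule instance is applicable to $\mathcal{S}_i$. $Z$ property: there is a compliant infinite time trace from $\mathcal{S}_0$ using l.t.s. A point-of-no-return is a configuration $\mathcal{S}$ that is not critical and such that every infinite trace starting from $\mathcal{S}$ using l.t.s. is not compliant. $V$ property (recoverability): $Z$ holds and no configuration reachable from $\mathcal{S}_0$ by a compliant trace using l.t.s. is a point-of-no-return. $L$ property (reliability): $Z$ holds and for every configuration $\mathcal{S}$ reachable from $\mathcal{S}_0$ by a compliant trace using l.t.s., there is a compliant infinite time trace from $\mathcal{S}$ using l.t.s. -}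

module Defs where

open import Data.Nat using (ℕ; zero; suc; _+_; _<_)
open import Data.Fin using (Fin)
open import Data.List using (List; []; _∷_; _++_; map)
open import Data.List.Relation.Unary.All using (All; []; _∷_)
open import Data.List.Membership.Propositional using (_∈_; _∉_)
open import Data.List.Relation.Binary.Permutation.Propositional using (_↭_)
open import Data.Maybe using (Maybe; just; nothing)
open import Data.Product using (Σ; _×_; _,_; ∃; proj₁; proj₂)
open import Data.Sum using (_⊎_; inj₁; inj₂)
open import Data.Unit using (⊤)
open import Relation.Nullary using (¬_)
open import Relation.Binary.PropositionalEquality using (_≡_; _≢_)

-- The special predicate Time is
-- not part of the alphabet; it is built into configurations and rules.

record Alphabet : Set where
  field
    nSort    : ℕ
    nFun     : ℕ
    nPred    : ℕ
    funArgs  : Fin nFun → List (Fin nSort)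
    funRes   : Fin nFun → Fin nSort
    predArgs : Fin nPred → List (Fin nSort)

-- Relations used in time constraints  T_a > T_b ± d   and  T_a = T_b ± d
data CRel : Set where
  gt eq : CRel

data CSign : Set where
  plus minus : CSign

record Constraint (n : ℕ) : Set where
  field
    rel  : CRel
    lhs  : Fin n
    rhs  : Fin n
    sign : CSign
    d    : ℕ

-- Integer reading of  T_a > T_b ± d  /  T_a = T_b ± d  over naturals.
SatC : {n : ℕ} → (Fin n → ℕ) → Constraint n → Set
SatC τ c with Constraint.rel c | Constraint.sign c
... | gt | plus  = τ (Constraint.rhs c) + Constraint.d c < τ (Constraint.lhs c)
... | gt | minus = τ (Constraint.rhs c) < τ (Constraint.lhs c) + Constraint.d c
... | eq | plus  = τ (Constraint.lhs c) ≡ τ (Constraint.rhs c) + Constraint.d c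
... | eq | minus = τ (Constraint.lhs c) + Constraint.d c ≡ τ (Constraint.rhs c)

SatAll : {n : ℕ} → (Fin n → ℕ) → List (Constraint n) → Set
SatAll τ cs = All (SatC τ) cs

module MSR (A : Alphabet) where
  open Alphabet A

  Sort : Set
  Sort = Fin nSort

  data Term (V : Sort → Set) : Sort → Set where
    var : ∀ {s} → V s → Term V s
    app : (f : Fin nFun) → All (Term V) (funArgs f) → Term V (funRes f)

  data Fact (V : Sort → Set) : Set where
    fact : (P : Fin nPred) → All (Term V) (predArgs P) → Fact V

  -- Ground terms: the only "variables" are nonces (fresh values), named by ℕ.
  Nonce : Sort → Set
  Nonce _ = ℕ

  GFact : Set
  GFact = Fact Nonce

  Subst : (Sort → Set) → (Sort → Set) → Set
  Subst V W = ∀ {s} → V s → Term W s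

  mutual
    substT : ∀ {V W s} → Subst V W → Term V s → Term W s
    substT σ (var x)    = σ x
    substT σ (app f ts) = app f (substTs σ ts)

    substTs : ∀ {V W ss} → Subst V W → All (Term V) ss → All (Term W) ss
    substTs σ []       = []
    substTs σ (t ∷ ts) = substT σ t ∷ substTs σ ts

  substF : ∀ {V W} → Subst V W → Fact V → Fact W
  substF σ (fact P ts) = fact P (substTs σ ts)

  mutual
    nonceT : ∀ {s} → Term Nonce s → List ℕ
    nonceT (var n)    = n ∷ []
    nonceT (app f ts) = nonceTs ts

    nonceTs : ∀ {ss} → All (Term Nonce) ss → List ℕ
    nonceTs []       = []
    nonceTs (t ∷ ts) = nonceT t ++ nonceTs ts

  nonceF : GFact → List ℕ
  nonceF (fact P ts) = nonceTs ts

  -- A configuration: the unique fact Time@time, plus a finite multiset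
  -- (list taken up to permutation) of ground timestamped facts F@t.
  record Config : Set where
    constructor config
    field
      time  : ℕ
      facts : List (GFact × ℕ)
  open Config public

  configNonces : Config → List ℕ
  configNonces S = go (facts S)
    where
    go : List (GFact × ℕ) → List ℕ
    go []             = []
    go ((F , _) ∷ Fs) = nonceF F ++ go Fs

  SVar : {k : ℕ} → (Fin k → Sort) → Sort → Set
  SVar {k} srt s = Σ (Fin k) (λ i → srt i ≡ s)

  -- Instantaneous rule
  --  Time@T, W_i@T_i, F_i@T_i' | C  →  ∃X. [Time@T, W_i@T_i, Q_i@(T+d_i)]
  record Rule : Set where
    field
      nVar      : ℕ
      varSort   : Fin nVar → Sort
      nFresh    : ℕ
      freshSort : Fin nFresh → Sort
      nTime     : ℕ
      now       : Fin nTime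
      kept      : List (Fact (SVar varSort) × Fin nTime)
      consumed  : List (Fact (SVar varSort) × Fin nTime)
      cstr      : List (Constraint nTime)
      produced  : List (Fact (λ s → SVar varSort s ⊎ SVar freshSort s) × ℕ)

  instTF : ∀ {V k} → Subst V Nonce → (Fin k → ℕ) → List (Fact V × Fin k) → List (GFact × ℕ)
  instTF σ τ = map (λ p → substF σ (proj₁ p) , τ (proj₂ p))

  FreshFor : {k : ℕ} → (Fin k → ℕ) → Config → Set
  FreshFor {k} ν S = (∀ i j → ν i ≡ ν j → i ≡ j) × (∀ i → ν i ∉ configNonces S)

  RuleStep : Rule → Config → Config → Set
  RuleStep r S S' =
    Σ (Subst (SVar varSort) Nonce) λ σ →
    Σ (Fin nTime → ℕ) λ τ →
    Σ (Fin nFresh → ℕ) λ ν →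
    Σ (List (GFact × ℕ)) λ rest →
      (τ now ≡ time S) × (time S' ≡ time S) × SatAll τ cstr × FreshFor ν S ×
      (facts S  ↭ (instTF σ τ kept ++ instTF σ τ consumed ++ rest)) ×
      (facts S' ↭ (instTF σ τ kept ++ postQ σ τ ν ++ rest))
    where
    open Rule r
    σ' : Subst (SVar varSort) Nonce → (Fin nFresh → ℕ) →
         Subst (λ s → SVar varSort s ⊎ SVar freshSort s) Nonce
    σ' σ ν (inj₁ x)       = σ x
    σ' σ ν (inj₂ (i , _)) = var (ν i)
    postQ : Subst (SVar varSort) Nonce → (Fin nTime → ℕ) → (Fin nFresh → ℕ) → List (GFact × ℕ)
    postQ σ τ ν = map (λ p → substF (σ' σ ν) (proj₁ p) , τ now + proj₂ p) produced

  Applicable : Rule → Config → Set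
  Applicable r S = ∃ λ S' → RuleStep r S S'

  TickStep : Config → Config → Set
  TickStep S S' = (time S' ≡ suc (time S)) × (facts S' ≡ facts S)

  System : Set
  System = List Rule

  LtsStep : System → Config → Config → Set
  LtsStep T S S' =
    (Σ Rule λ r → (r ∈ T) × RuleStep r S S')
    ⊎ (TickStep S S' × (∀ r → r ∈ T → ¬ Applicable r S))

  record CritPattern : Set where
    field
      nVar    : ℕ
      varSort : Fin nVar → Sort
      nTime   : ℕ
      timeVar : Maybe (Fin nTime)
      pfacts  : List (Fact (SVar varSort) × Fin nTime)
      cstr    : List (Constraint nTime)

  CritSpec : Set
  CritSpec = List CritPattern

  MatchTime : {k : ℕ} → Maybe (Fin k) → (Fin k → ℕ) → ℕ → Set
  MatchTime nothing  τ t = ⊤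
  MatchTime (just x) τ t = τ x ≡ t

  Instance : CritPattern → Config → Set
  Instance p S =
    Σ (Subst (SVar varSort) Nonce) λ σ →
    Σ (Fin nTime → ℕ) λ τ →
    Σ (List (GFact × ℕ)) λ rest →
      MatchTime timeVar τ (time S) × SatAll τ cstr ×
      (facts S ↭ (instTF σ τ pfacts ++ rest))
    where open CritPattern p

  Critical : CritSpec → Config → Set
  Critical CS S = Σ CritPattern λ p → (p ∈ CS) × Instance p S

  record InfTrace (T : System) (S : Config) : Set where
    field
      conf  : ℕ → Config
      start : conf 0 ≡ S
      step  : ∀ i → LtsStep T (conf i) (conf (suc i))

  Compliant : {T : System} {S : Config} → CritSpec → InfTrace T S → Set
  Compliant CS tr = ∀ i → ¬ Critical CS (InfTrace.conf tr i)

  InfiniteTime : {T : System} {S : Config} → InfTrace T S → Set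
  InfiniteTime tr = ∀ n → ∃ λ i → n < time (InfTrace.conf tr i)

  data Reach (T : System) (CS : CritSpec) (S₀ : Config) : Config → Set where
    here  : ¬ Critical CS S₀ → Reach T CS S₀ S₀
    there : ∀ {S₁ S₂} → Reach T CS S₀ S₁ → LtsStep T S₁ S₂ →
            ¬ Critical CS S₂ → Reach T CS S₀ S₂

  Z : System → Config → CritSpec → Set
  Z T S CS = Σ (InfTrace T S) λ tr → InfiniteTime tr × Compliant CS tr

  PointOfNoReturn : System → CritSpec → Config → Set
  PointOfNoReturn T CS S =
    ¬ Critical CS S × ((tr : InfTrace T S) → ¬ Compliant CS tr)

  V : System → Config → CritSpec → Set
  V T S₀ CS = Z T S₀ CS × (∀ S → Reach T CS S₀ S → ¬ PointOfNoReturn T CS S)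

  L : System → Config → CritSpec → Set
  L T S₀ CS = Z T S₀ CS × (∀ S → Reach T CS S₀ S → Z T S CS)

{-# OPTIONS --safe #-}
module Submission where

open import Defs
open import Data.Product using (Σ; _×_; _,_; proj₁; ∃)
open import Relation.Nullary using (¬_; Dec; yes; no)
import Relation.Nullary.Decidable as Dec
open import Data.Empty using (⊥-elim)
open import Data.Nat using (ℕ; zero; suc; _+_)
open import Data.Nat.Properties using (+-identityʳ; +-suc; m≤n+m; <-irrefl)
open import Data.Fin using (Fin) renaming (zero to fz; suc to fs)
import Data.Fin as Fin
open import Data.List using (List; []; _∷_; _++_)
open import Data.List.Relation.Unary.All using ([])
open import Data.List.Relation.Unary.Any using (Any; here; there; any?)
open import Data.List.Membership.Propositional using (_∈_; _∉_; find; lose)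
open import Data.List.Membership.Propositional.Properties using (∈-++⁻; ∈-++⁺ˡ; ∈-++⁺ʳ; ∈-∃++)
open import Data.List.Relation.Binary.Permutation.Propositional using (_↭_; ↭-refl; ↭-sym)
open import Data.List.Relation.Binary.Permutation.Propositional.Properties using (∈-resp-↭; shift)
open import Data.Sum using (_⊎_; inj₁; inj₂)
open import Relation.Binary.PropositionalEquality using (_≡_; refl; sym; trans; cong; subst)

-- L ⇒ V: a point-of-no-return admits no compliant infinite trace, whereas L
-- provides one (even with infinite time) from every compliantly reachable
-- configuration.
--
-- For the converse take nullary facts a and b, rules a → b, a → ∅ and b → b
-- (the last one keeps b), and no critical configurations.  From a@0 one can
-- drop a and let time run, so Z holds, and every configuration has some
-- infinite trace, so there is no point-of-no-return.  But after a → b the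
-- rule b → b is enabled forever, so lazy time sampling never lets Tick fire
-- and no trace from there has infinite time: L fails.

∈⇒↭∷ : ∀ {a} {X : Set a} {x : X} {xs} → x ∈ xs → ∃ λ rest → xs ↭ x ∷ rest
∈⇒↭∷ x∈xs with ys , zs , refl ← ∈-∃++ x∈xs = ys ++ zs , shift _ ys zs

∈-++-replace : ∀ {a} {X : Set a} {x : X} ks cs qs rest →
               x ∈ ks ++ cs ++ rest → x ∉ cs → x ∈ ks ++ qs ++ rest
∈-++-replace ks cs qs rest x∈ x∉cs with ∈-++⁻ ks x∈
... | inj₁ x∈ks = ∈-++⁺ˡ x∈ks
... | inj₂ x∈′ with ∈-++⁻ cs x∈′
...   | inj₁ x∈cs   = ⊥-elim (x∉cs x∈cs)
...   | inj₂ x∈rest = ∈-++⁺ʳ ks (∈-++⁺ʳ qs x∈rest)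

module Properties {A : Alphabet} where
  open MSR A

  Quiescent : System → Config → Set
  Quiescent T S = ∀ r → r ∈ T → ¬ Applicable r S

  L⇒V : ∀ {T S₀ CS} → L T S₀ CS → V T S₀ CS
  L⇒V (z , z-everywhere) = z , λ S reach (_ , noCompliant) →
    let tr , _ , compliant = z-everywhere S reach in noCompliant tr compliant

  ¬Critical[] : ∀ S → ¬ Critical [] S
  ¬Critical[] S (_ , () , _)

  V-without-criticals : ∀ {T S₀} → Z T S₀ [] →
                        (∀ S → Reach T [] S₀ S → InfTrace T S) → V T S₀ []
  V-without-criticals z trace = z , λ S reach (_ , noCompliant) →
    noCompliant (trace S reach) (λ i → ¬Critical[] _)

  _◅_ : ∀ {T S S′} → LtsStep T S S′ → InfTrace T S′ → InfTrace T S
  _◅_ {T} {S} s tr = record { conf = conf′ ; start = refl ; step = step′ }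
    where
    open InfTrace tr
    conf′ : ℕ → Config
    conf′ zero    = S
    conf′ (suc i) = conf i
    step′ : ∀ i → LtsStep T (conf′ i) (conf′ (suc i))
    step′ zero    = subst (LtsStep T S) (sym start) s
    step′ (suc i) = step i

  ◅-infiniteTime : ∀ {T S S′} (s : LtsStep T S S′) (tr : InfTrace T S′) →
                   InfiniteTime tr → InfiniteTime (s ◅ tr)
  ◅-infiniteTime s tr inf n with i , n<t ← inf n = suc i , n<t

  repeat : ∀ {T S} → LtsStep T S S → InfTrace T S
  repeat s = record { conf = λ _ → _ ; start = refl ; step = λ _ → s }

  ticking : ∀ {T} (t : ℕ) (xs : List (GFact × ℕ)) → (∀ n → Quiescent T (config (t + n) xs)) → InfTrace T (config t xs)
  ticking t xs quiet = record
    { conf  = λ n → config (t + n) xs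
    ; start = cong (λ t′ → config t′ xs) (+-identityʳ t)
    ; step  = λ n → inj₂ ((+-suc t n , refl) , quiet n)
    }

  ticking-infiniteTime : ∀ {T} (t : ℕ) (xs : List (GFact × ℕ)) (quiet : ∀ n → Quiescent T (config (t + n) xs)) →
                         InfiniteTime (ticking t xs quiet)
  ticking-infiniteTime t xs quiet n = suc n , m≤n+m (suc n) t

  ruleStep-preserves-∈ : ∀ {r S S′ x} →
    (∀ (σ : Subst (SVar (Rule.varSort r)) Nonce) (τ : Fin (Rule.nTime r) → ℕ) →
       x ∉ instTF σ τ (Rule.consumed r)) →
    RuleStep r S S′ → x ∈ facts S → x ∈ facts S′
  ruleStep-preserves-∈ {r} notConsumed (σ , τ , _ , rest , _ , _ , _ , _ , before , after) x∈ =
    ∈-resp-↭ (↭-sym after)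
      (∈-++-replace (instTF σ τ kept) _ _ rest (∈-resp-↭ before x∈) (notConsumed σ τ))
    where open Rule r

  -- Only Tick changes the global time, and lazy time sampling forbids Tick
  -- as long as some rule is enabled.
  enabled-freezes-time : ∀ {T} (P : Config → Set) →
    (∀ {S S′} → P S → LtsStep T S S′ → P S′) → (∀ {S} → P S → ¬ Quiescent T S) →
    ∀ {S} → P S → (tr : InfTrace T S) → ¬ InfiniteTime tr
  enabled-freezes-time {T} P preserved enabled {S} pS tr inf
    with i , t<tᵢ ← inf (time S)
    = <-irrefl (sym (proj₁ (frozen i))) t<tᵢ
    where
    open InfTrace tr
    sameTime : ∀ {S₁ S₂} → P S₁ → LtsStep T S₁ S₂ → time S₂ ≡ time S₁
    sameTime _    (inj₁ (_ , _ , _ , _ , _ , _ , _ , same , _)) = same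
    sameTime pS₁ (inj₂ (_ , quiet)) = ⊥-elim (enabled pS₁ quiet)
    frozen : ∀ i → (time (conf i) ≡ time S) × P (conf i)
    frozen zero    rewrite start = refl , pS
    frozen (suc i) with same , pᵢ ← frozen i =
      trans (sameTime pᵢ (step i)) same , preserved pᵢ (step i)

module Counterexample where
  alphabet : Alphabet
  alphabet = record
    { nSort = 0 ; nFun = 0 ; nPred = 2
    ; funArgs = λ () ; funRes = λ () ; predArgs = λ _ → [] }

  open MSR alphabet
  open Properties {alphabet}

  pa pb : Fin 2
  pa = fz
  pb = fs fz

  atom : ∀ {V} → Fin 2 → Fact V
  atom P = fact P []

  NoVar : Sort → Set
  NoVar = SVar {0} (λ ())

  -- Time variable fz is the rule's T, and fs fz the timestamp of its premise.
  nullaryRule : List (Fact NoVar × Fin 2) → List (Fact NoVar × Fin 2) →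
                List (Fact (λ s → NoVar s ⊎ NoVar s) × ℕ) → Rule
  nullaryRule k c q = record
    { nVar = 0 ; varSort = λ () ; nFresh = 0 ; freshSort = λ ()
    ; nTime = 2 ; now = fz ; kept = k ; consumed = c ; cstr = [] ; produced = q }

  a⇒b a⇒∅ b⇒b : Rule
  a⇒b = nullaryRule [] ((atom pa , fs fz) ∷ []) ((atom pb , 0) ∷ [])
  a⇒∅ = nullaryRule [] ((atom pa , fs fz) ∷ []) []
  b⇒b = nullaryRule ((atom pb , fs fz) ∷ []) [] []

  system : System
  system = a⇒b ∷ a⇒∅ ∷ b⇒b ∷ []

  S₀ : Config
  S₀ = config 0 ((atom pa , 0) ∷ [])

  Present : Fin 2 → List (GFact × ℕ) → Set
  Present P xs = ∃ λ t → (atom P , t) ∈ xs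

  present? : ∀ P xs → Dec (Present P xs)
  present? P xs = Dec.map′ found (λ (_ , x∈) → lose x∈ refl) (any? (λ x → atom? (proj₁ x)) xs)
    where
    found : Any (λ x → proj₁ x ≡ atom P) xs → Present P xs
    found p with (_ , t) , x∈ , refl ← find p = t , x∈
    atom? : (F : GFact) → Dec (F ≡ atom P)
    atom? (fact Q []) = Dec.map′ (cong atom) (λ { refl → refl }) (Q Fin.≟ P)

  noSubst : Subst NoVar Nonce
  noSubst (() , _)

  timeVars : ℕ → ℕ → Fin 2 → ℕ
  timeVars now _ fz     = now
  timeVars _   t (fs _) = t

  noFresh : ∀ S → FreshFor {0} (λ ()) S
  noFresh S = (λ ()) , (λ ())

  a⇒b-step : ∀ S t rest → facts S ↭ (atom pa , t) ∷ rest →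
             RuleStep a⇒b S (config (time S) ((atom pb , time S + 0) ∷ rest))
  a⇒b-step S t rest p = noSubst , timeVars (time S) t , _ , rest , refl , refl , [] , noFresh S , p , ↭-refl

  a⇒∅-step : ∀ S t rest → facts S ↭ (atom pa , t) ∷ rest → RuleStep a⇒∅ S (config (time S) rest)
  a⇒∅-step S t rest p = noSubst , timeVars (time S) t , _ , rest , refl , refl , [] , noFresh S , p , ↭-refl

  b⇒b-step : ∀ S → Present pb (facts S) → RuleStep b⇒b S S
  b⇒b-step S (t , b∈) with rest , p ← ∈⇒↭∷ b∈ =
    noSubst , timeVars (time S) t , _ , rest , refl , refl , [] , noFresh S , p , p

  b-enabled : ∀ {S} → Present pb (facts S) → ¬ Quiescent system S
  b-enabled {S} b quiet = quiet b⇒b (there (there (here refl))) (S , b⇒b-step S b)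

  quiescent : ∀ {S} → ¬ Present pa (facts S) → ¬ Present pb (facts S) → Quiescent system S
  quiescent ¬a ¬b _ (here refl)                 (_ , _ , _ , _ , _ , _ , _ , _ , _ , p , _) =
    ¬a (_ , ∈-resp-↭ (↭-sym p) (here refl))
  quiescent ¬a ¬b _ (there (here refl))         (_ , _ , _ , _ , _ , _ , _ , _ , _ , p , _) =
    ¬a (_ , ∈-resp-↭ (↭-sym p) (here refl))
  quiescent ¬a ¬b _ (there (there (here refl))) (_ , _ , _ , _ , _ , _ , _ , _ , _ , p , _) =
    ¬b (_ , ∈-resp-↭ (↭-sym p) (here refl))

  b-persists : ∀ {S S′} → Present pb (facts S) → LtsStep system S S′ → Present pb (facts S′)
  b-persists (t , b∈) (inj₁ (_ , here refl , step)) =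
    t , ruleStep-preserves-∈ {a⇒b} (λ { _ _ (here ()) }) step b∈
  b-persists (t , b∈) (inj₁ (_ , there (here refl) , step)) =
    t , ruleStep-preserves-∈ {a⇒∅} (λ { _ _ (here ()) }) step b∈
  b-persists (t , b∈) (inj₁ (_ , there (there (here refl)) , step)) =
    t , ruleStep-preserves-∈ {b⇒b} (λ _ _ ()) step b∈
  b-persists b (inj₂ ((_ , same) , _)) = subst (Present pb) (sym same) b

  someTrace : ∀ S → InfTrace system S
  someTrace S with present? pb (facts S) | present? pa (facts S)
  ... | yes b | _ = repeat (inj₁ (b⇒b , there (there (here refl)) , b⇒b-step S b))
  ... | no ¬b | no ¬a = ticking (time S) (facts S) (λ _ → quiescent ¬a ¬b)
  ... | no _  | yes (t , a∈) with rest , p ← ∈⇒↭∷ a∈ =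
    inj₁ (a⇒b , here refl , a⇒b-step S t rest p)
      ◅ repeat (inj₁ (b⇒b , there (there (here refl)) , b⇒b-step _ (_ , here refl)))

  drop-a : LtsStep system S₀ (config 0 [])
  drop-a = inj₁ (a⇒∅ , there (here refl) , a⇒∅-step S₀ 0 [] ↭-refl)

  Z-S₀ : Z system S₀ []
  Z-S₀ = drop-a ◅ ticking 0 [] idle
       , ◅-infiniteTime drop-a _ (ticking-infiniteTime 0 [] idle)
       , λ _ → ¬Critical[] _
    where
    idle : ∀ n → Quiescent system (config n [])
    idle _ = quiescent (λ ()) (λ ())

  V-S₀ : V system S₀ []
  V-S₀ = V-without-criticals Z-S₀ (λ S _ → someTrace S)

  reach-b : Reach system [] S₀ (config 0 ((atom pb , 0) ∷ []))
  reach-b = there (here (¬Critical[] S₀)) (inj₁ (a⇒b , here refl , a⇒b-step S₀ 0 [] ↭-refl))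
                  (¬Critical[] _)

  ¬L-S₀ : ¬ L system S₀ []
  ¬L-S₀ (_ , z-everywhere) with tr , inf , _ ← z-everywhere _ reach-b =
    enabled-freezes-time (λ S → Present pb (facts S)) b-persists b-enabled (_ , here refl) tr inf

proposition7 : ((A : Alphabet) (T : MSR.System A) (S₀ : MSR.Config A) (CS : MSR.CritSpec A) →
                  MSR.L A T S₀ CS → MSR.V A T S₀ CS)
               × Σ Alphabet (λ A → Σ (MSR.System A) (λ T → Σ (MSR.Config A) (λ S₀ →
                   Σ (MSR.CritSpec A) (λ CS → MSR.V A T S₀ CS × ¬ MSR.L A T S₀ CS))))
proposition7 = (λ _ _ _ _ → L⇒V)
             , alphabet , system , S₀ , [] , V-S₀ , ¬L-S₀
  where
  open Properties
  open Counterexample
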